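{- Let $S_i=K_{1,i}$ denote the star with one center vertex and $i$ leaves. If $n\geq 2$ then $\mathrm{cat}(S_n)=2$. Moreover $\mathrm{cat}(S_0)=0$ and $\mathrm{cat}(S_1)=1$.
   Context: Cat Herding is a two-player game on a finite simple graph $G$ between a cat and a herder. First the cat places its token on a starting vertex. Then the players alternate, the herder moving first: on the herder's turn it deletes one edge of the current graph (a "cut"); on the cat's turn the cat must move its token along a path of the current graph to a different vertex. The game ends when the cat's current vertex has no incident edges (in particular the score is $0$ if the cat starts on an isolated vertex). The score is the total number of edges deleted; the herder minimizes and the cat maximizes it. For $v\in V(G)$, $\mathrm{cat}(G,v)$ is the optimal-play score when the cat starts at $v$, and $\mathrm{cat}(G)=\max_{v\in V(G)}\mathrm{cat}(G,v)$. -}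

module Defs where

open import Data.Nat using (ℕ; zero; suc; _≤_)
open import Data.Fin using (Fin; zero; suc; _≟_)
open import Data.Bool using (Bool; true; false; _∧_; _∨_; not)
open import Data.Product using (Σ; ∃; _×_; _,_)
open import Data.Sum using (_⊎_)
open import Relation.Nullary using (¬_)
open import Relation.Nullary.Decidable using (⌊_⌋)
open import Relation.Binary.PropositionalEquality using (_≡_; _≢_)
open import Relation.Binary.Construct.Closure.ReflexiveTransitive using (Star)

Adj : ℕ → Set
Adj n = Fin n → Fin n → Bool

record SimpleGraph (n : ℕ) : Set where
  field
    adj     : Adj n
    sym     : ∀ a b → adj a b ≡ adj b a
    irrefl  : ∀ a → adj a a ≡ false
open SimpleGraph public

deleteEdge : ∀ {n} → Adj n → Fin n → Fin n → Adj n
deleteEdge E u w a b =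
  E a b ∧ not ((⌊ a ≟ u ⌋ ∧ ⌊ b ≟ w ⌋) ∨ (⌊ a ≟ w ⌋ ∧ ⌊ b ≟ u ⌋))

Isolated : ∀ {n} → Adj n → Fin n → Set
Isolated E v = ∀ x → E v x ≡ false

Reach : ∀ {n} → Adj n → Fin n → Fin n → Set
Reach E = Star (λ a b → E a b ≡ true)

-- HerderAtMost k E v : herder to move, current edge set E, cat at v;
-- the herder can ensure that at most k further edges are deleted.
data HerderAtMost {n : ℕ} : ℕ → Adj n → Fin n → Set where
  over : ∀ {k E v} → Isolated E v → HerderAtMost k E v
  cut  : ∀ {k E v} (u w : Fin n) → E u w ≡ true →
         (∀ x → x ≢ v → Reach (deleteEdge E u w) v x →
            HerderAtMost k (deleteEdge E u w) x) →
         HerderAtMost (suc k) E v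

-- CatAtLeast k E v : herder to move, current edge set E, cat at v;
-- the cat can ensure that at least k further edges are deleted.
data CatAtLeast {n : ℕ} : ℕ → Adj n → Fin n → Set where
  trivial : ∀ {E v} → CatAtLeast 0 E v
  survive : ∀ {k E v} → ¬ Isolated E v →
            (∀ u w → E u w ≡ true →
               (k ≡ 0) ⊎ Σ (Fin n) (λ x → x ≢ v × Reach (deleteEdge E u w) v x
                                         × CatAtLeast k (deleteEdge E u w) x)) →
            CatAtLeast (suc k) E v

CatValue : ∀ {n} → SimpleGraph n → Fin n → ℕ → Set
CatValue G v k = CatAtLeast k (adj G) v × HerderAtMost k (adj G) v

CatNumber : ∀ {n} → SimpleGraph n → ℕ → Set
CatNumber {n} G k =
  (∀ v → ∃ λ k′ → CatValue G v k′) ×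
  (Σ (Fin n) λ v → CatValue G v k) ×
  (∀ v k′ → CatValue G v k′ → k′ ≤ k)

-- The star S_i = K_{1,i}: vertex 0 is the centre, vertices 1..i are leaves.
starAdj : (i : ℕ) → Adj (suc i)
starAdj i zero    zero    = false
starAdj i zero    (suc _) = true
starAdj i (suc _) zero    = true
starAdj i (suc _) (suc _) = false

starSym : (i : ℕ) → ∀ a b → starAdj i a b ≡ starAdj i b a
starSym i zero    zero    = _≡_.refl
starSym i zero    (suc _) = _≡_.refl
starSym i (suc _) zero    = _≡_.refl
starSym i (suc _) (suc _) = _≡_.refl

starIrrefl : (i : ℕ) → ∀ a → starAdj i a a ≡ false
starIrrefl i zero    = _≡_.refl
starIrrefl i (suc _) = _≡_.refl

Star-graph : (i : ℕ) → SimpleGraph (suc i)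
Star-graph i = record { adj = starAdj i ; sym = starSym i ; irrefl = starIrrefl i }

{-# OPTIONS --safe #-}
-- A leaf has a single edge, which the herder cuts at once, so its value is 1.  From the
-- centre of a star with at least two leaves the cat survives any first cut by running to
-- a leaf that is still attached, which forces a second cut; conversely the herder's first
-- cut strands one leaf, and whichever other leaf the cat runs to is stranded by the second.
module Submission where

open import Defs hiding (sym)
open import Data.Nat using (ℕ; _≤_; zero; suc; z≤n; s≤s)
open import Data.Nat.Properties using (≤-refl; ≤-trans)
open import Data.Product using (Σ; _×_; _,_; proj₂)
open import Data.Fin using (Fin; zero; suc; _≟_)
open import Data.Bool using (true; false)
open import Data.Bool.Properties using (∧-zeroʳ)
open import Data.Sum using (inj₁; inj₂)
open import Data.Empty using (⊥-elim)
open import Relation.Nullary using (¬_; Dec; yes; no)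
open import Relation.Binary.PropositionalEquality using (_≡_; refl; trans; sym; _≢_)
open import Relation.Binary.Construct.Closure.ReflexiveTransitive using (ε; _◅_)

true≢false : true ≢ false
true≢false ()

edge⇒¬isolated : ∀ {n} {E : Adj n} {v x} → E v x ≡ true → ¬ Isolated E v
edge⇒¬isolated {x = x} e iso = true≢false (trans (sym e) (iso x))

isolated⇒reach-trivial : ∀ {n} {E : Adj n} {v x} → Isolated E v → Reach E v x → x ≡ v
isolated⇒reach-trivial         iso ε       = refl
isolated⇒reach-trivial {E = E} iso (e ◅ _) = ⊥-elim (edge⇒¬isolated {E = E} e iso)

deleteEdge-removes : ∀ {n} (E : Adj n) u w → deleteEdge E u w u w ≡ false
deleteEdge-removes E u w with u ≟ u | w ≟ w
... | yes _   | yes _   = ∧-zeroʳ (E u w)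
... | no u≢u  | _       = ⊥-elim (u≢u refl)
... | yes _   | no w≢w  = ⊥-elim (w≢w refl)

deleteEdge-absent : ∀ {n} (E : Adj n) u w {a b} → E a b ≡ false → deleteEdge E u w a b ≡ false
deleteEdge-absent E u w e rewrite e = refl

deleteEdge-isolates : ∀ {n} (E : Adj n) {v w} → (∀ x → x ≢ w → E v x ≡ false) →
                      Isolated (deleteEdge E v w) v
deleteEdge-isolates E {v} {w} others x = byCases (x ≟ w)
  where
  byCases : Dec (x ≡ w) → deleteEdge E v w v x ≡ false
  byCases (yes refl) = deleteEdge-removes E v w
  byCases (no x≢w)   = deleteEdge-absent E v w (others x x≢w)

catAtLeast-≤-herderAtMost : ∀ {n a b} {E : Adj n} {v} →
                            CatAtLeast a E v → HerderAtMost b E v → a ≤ b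
catAtLeast-≤-herderAtMost trivial               _                = z≤n
catAtLeast-≤-herderAtMost (survive ¬iso _)      (over iso)       = ⊥-elim (¬iso iso)
catAtLeast-≤-herderAtMost (survive _ escape)    (cut u w e herd) with escape u w e
... | inj₁ refl                  = s≤s z≤n
... | inj₂ (x , x≢v , r , catX) = s≤s (catAtLeast-≤-herderAtMost catX (herd x x≢v r))

catAtLeast-one : ∀ {n} {E : Adj n} {v x} → E v x ≡ true → CatAtLeast 1 E v
catAtLeast-one {E = E} e = survive (edge⇒¬isolated {E = E} e) (λ _ _ _ → inj₁ refl)

catAtLeast-two : ∀ {n} {E : Adj n} {v x} → E v x ≡ true →
                 (∀ u w → E u w ≡ true → Σ (Fin n) λ y →
                    y ≢ v × deleteEdge E u w v y ≡ true × deleteEdge E u w y v ≡ true) →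
                 CatAtLeast 2 E v
catAtLeast-two {E = E} e flee = survive (edge⇒¬isolated {E = E} e) λ u w cutEdge →
  let (y , y≢v , there , back) = flee u w cutEdge
  in  inj₂ (y , y≢v , there ◅ ε , catAtLeast-one back)

herderAtMost-cutLastEdge : ∀ {n k} {E : Adj n} {v w} → E v w ≡ true →
                           (∀ x → x ≢ w → E v x ≡ false) → HerderAtMost (suc k) E v
herderAtMost-cutLastEdge {E = E} {v} {w} e others =
  cut v w e λ x x≢v r → ⊥-elim (x≢v (isolated⇒reach-trivial (deleteEdge-isolates E others) r))

catNumber-from-values : ∀ {n} (G : SimpleGraph n) (val : Fin n → ℕ) →
                        (∀ v → CatValue G v (val v)) →
                        (v₀ : Fin n) → (∀ v → val v ≤ val v₀) → CatNumber G (val v₀)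
catNumber-from-values G val optimal v₀ maximal =
  (λ v → val v , optimal v) , (v₀ , optimal v₀) ,
  λ v k′ (catV , _) → ≤-trans (catAtLeast-≤-herderAtMost catV (proj₂ (optimal v))) (maximal v)

star-leaf-others : ∀ {m} (j : Fin m) x → x ≢ zero → starAdj m (suc j) x ≡ false
star-leaf-others j zero    x≢0 = ⊥-elim (x≢0 refl)
star-leaf-others j (suc x) _   = refl

star-leafValue : ∀ m (j : Fin m) → CatValue (Star-graph m) (suc j) 1
star-leafValue m j = catAtLeast-one {x = zero} refl , herderAtMost-cutLastEdge refl (star-leaf-others j)

module Centre (m : ℕ) where

  S : Adj (suc (suc (suc m)))
  S = starAdj (suc (suc m))

  S∖01 : Adj (suc (suc (suc m)))
  S∖01 = deleteEdge S (suc zero) zero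

  catCentre : CatAtLeast 2 S zero
  catCentre = catAtLeast-two {x = suc zero} refl flee
    where
    flee : ∀ u w → S u w ≡ true → Σ (Fin (suc (suc (suc m)))) λ y →
           y ≢ zero × deleteEdge S u w zero y ≡ true × deleteEdge S u w y zero ≡ true
    flee zero          (suc zero)    _ = suc (suc zero) , (λ ()) , refl , refl
    flee zero          (suc (suc _)) _ = suc zero       , (λ ()) , refl , refl
    flee (suc zero)    zero          _ = suc (suc zero) , (λ ()) , refl , refl
    flee (suc (suc _)) zero          _ = suc zero       , (λ ()) , refl , refl

  herderCentre : HerderAtMost 2 S zero
  herderCentre = cut (suc zero) zero refl afterFirstCut
    where
    afterFirstCut : ∀ x → x ≢ zero → Reach S∖01 zero x → HerderAtMost 1 S∖01 x
    afterFirstCut zero          x≢0 _ = ⊥-elim (x≢0 refl)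
    afterFirstCut (suc zero)    _   _ = over (deleteEdge-isolates S (star-leaf-others zero))
    afterFirstCut (suc (suc j)) _   _ = herderAtMost-cutLastEdge refl λ x x≢0 →
      deleteEdge-absent S (suc zero) zero (star-leaf-others (suc j) x x≢0)

star≥2-value : ∀ m → Fin (suc (suc (suc m))) → ℕ
star≥2-value m zero    = 2
star≥2-value m (suc _) = 1

star≥2-catNumber : ∀ m → CatNumber (Star-graph (suc (suc m))) 2
star≥2-catNumber m =
  catNumber-from-values (Star-graph (suc (suc m))) (star≥2-value m) optimal zero maximal
  where
  open Centre m
  optimal : ∀ v → CatValue (Star-graph (suc (suc m))) v (star≥2-value m v)
  optimal zero    = catCentre , herderCentre
  optimal (suc j) = star-leafValue _ j
  maximal : ∀ v → star≥2-value m v ≤ 2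
  maximal zero    = ≤-refl
  maximal (suc _) = s≤s z≤n

star0-catNumber : CatNumber (Star-graph 0) 0
star0-catNumber = catNumber-from-values (Star-graph 0) (λ _ → 0) optimal zero (λ _ → ≤-refl)
  where
  optimal : ∀ v → CatValue (Star-graph 0) v 0
  optimal zero = trivial , over λ { zero → refl }

star1-catNumber : CatNumber (Star-graph 1) 1
star1-catNumber = catNumber-from-values (Star-graph 1) (λ _ → 1) optimal zero (λ _ → ≤-refl)
  where
  optimal : ∀ v → CatValue (Star-graph 1) v 1
  optimal zero       = catAtLeast-one {x = suc zero} refl ,
                       herderAtMost-cutLastEdge {w = suc zero} refl
                         λ { zero _ → refl ; (suc zero) x≢1 → ⊥-elim (x≢1 refl) }
  optimal (suc zero) = star-leafValue 1 zero

mainTheorem4 : ((n : ℕ) → 2 ≤ n → CatNumber (Star-graph n) 2)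
                 × CatNumber (Star-graph 0) 0
                 × CatNumber (Star-graph 1) 1
mainTheorem4 = atLeastTwoLeaves , star0-catNumber , star1-catNumber
  where
  atLeastTwoLeaves : (n : ℕ) → 2 ≤ n → CatNumber (Star-graph n) 2
  atLeastTwoLeaves (suc (suc m)) _          = star≥2-catNumber m
  atLeastTwoLeaves (suc zero)    (s≤s ())
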